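{- Let $\mathcal C$ be a category having a subobject classifier $\mathsf{true}:\mathtt 1\to\Omega$. If $\mathcal C$ has binary products, then $\mathcal C$ has limits of all finite diagrams; in particular it has equalizers and pullbacks.
   Context: Let $\mathcal C$ have a terminal object $\mathtt 1$. A subobject classifier is a morphism $\mathsf{true}:\mathtt 1\to\Omega$ such that (1) for every $\chi:A\to\Omega$ the cospan $\mathtt 1\xrightarrow{\mathsf{true}}\Omega\xleftarrow{\chi}A$ has a pullback, and (2) for every monomorphism $i:X\to A$ there is a unique $\chi_i:A\to\Omega$ such that the square formed by $i$, $\chi_i$, $X\to\mathtt 1$, $\mathsf{true}$ is a pullback. A finite diagram is a functor $D:\mathcal D\to\mathcal C$ from a category $\mathcal D$ with finitely many morphisms; a limit of $D$ is a universal cone over $D$. -}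

module Defs where

open import Level using (Level; _⊔_) renaming (suc to lsuc)
open import Data.Nat using (ℕ)
open import Data.Fin using (Fin)
open import Data.Product using (Σ; Σ-syntax; _×_; _,_)
open import Function.Bundles using (_↔_)
open import Relation.Binary.PropositionalEquality using (_≡_)

-- A (locally small) category; equality of morphisms is propositional equality.
record Category (o ℓ : Level) : Set (lsuc (o ⊔ ℓ)) where
  infixr 9 _∘_
  field
    Obj       : Set o
    _⇒_       : Obj → Obj → Set ℓ
    id        : ∀ {A} → A ⇒ A
    _∘_       : ∀ {A B C} → B ⇒ C → A ⇒ B → A ⇒ C
    identityˡ : ∀ {A B} (f : A ⇒ B) → id ∘ f ≡ f
    identityʳ : ∀ {A B} (f : A ⇒ B) → f ∘ id ≡ f
    assoc     : ∀ {A B C D} (h : C ⇒ D) (g : B ⇒ C) (f : A ⇒ B) →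
                (h ∘ g) ∘ f ≡ h ∘ (g ∘ f)

Mor : ∀ {o ℓ} → Category o ℓ → Set (o ⊔ ℓ)
Mor D = Σ[ a ∈ Obj ] Σ[ b ∈ Obj ] (a ⇒ b)
  where open Category D

FiniteCategory : ∀ {o ℓ} → Category o ℓ → Set (o ⊔ ℓ)
FiniteCategory D = Σ[ n ∈ ℕ ] (Mor D ↔ Fin n)

record Functor {o ℓ o' ℓ'} (D : Category o ℓ) (C : Category o' ℓ')
       : Set (o ⊔ ℓ ⊔ o' ⊔ ℓ') where
  private
    module D = Category D
    module C = Category C
  field
    F₀          : D.Obj → C.Obj
    F₁          : ∀ {X Y} → X D.⇒ Y → F₀ X C.⇒ F₀ Y
    identity    : ∀ {X} → F₁ (D.id {X}) ≡ C.id
    homomorphism : ∀ {X Y Z} (g : Y D.⇒ Z) (f : X D.⇒ Y) →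
                   F₁ (g D.∘ f) ≡ F₁ g C.∘ F₁ f

module _ {o ℓ} (C : Category o ℓ) where
  open Category C

  record IsTerminal (T : Obj) : Set (o ⊔ ℓ) where
    field
      !        : ∀ A → A ⇒ T
      !-unique : ∀ {A} (f : A ⇒ T) → f ≡ ! A

  Mono : ∀ {X A} → X ⇒ A → Set (o ⊔ ℓ)
  Mono {X} i = ∀ {Z} (g h : Z ⇒ X) → i ∘ g ≡ i ∘ h → g ≡ h

  record IsPullback {A B Cc P : Obj} (f : A ⇒ Cc) (g : B ⇒ Cc)
                    (p₁ : P ⇒ A) (p₂ : P ⇒ B) : Set (o ⊔ ℓ) where
    field
      commute   : f ∘ p₁ ≡ g ∘ p₂
      universal : ∀ {Z} (h₁ : Z ⇒ A) (h₂ : Z ⇒ B) → f ∘ h₁ ≡ g ∘ h₂ →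
                  Σ[ u ∈ Z ⇒ P ] ((p₁ ∘ u ≡ h₁ × p₂ ∘ u ≡ h₂) ×
                    (∀ (v : Z ⇒ P) → p₁ ∘ v ≡ h₁ → p₂ ∘ v ≡ h₂ → v ≡ u))

  record HasPullback {A B Cc : Obj} (f : A ⇒ Cc) (g : B ⇒ Cc) : Set (o ⊔ ℓ) where
    field
      P          : Obj
      p₁         : P ⇒ A
      p₂         : P ⇒ B
      isPullback : IsPullback f g p₁ p₂

  record Equalizer {A B : Obj} (f g : A ⇒ B) : Set (o ⊔ ℓ) where
    field
      E         : Obj
      e         : E ⇒ A
      equality  : f ∘ e ≡ g ∘ e
      universal : ∀ {Z} (h : Z ⇒ A) → f ∘ h ≡ g ∘ h →
                  Σ[ u ∈ Z ⇒ E ] (e ∘ u ≡ h × (∀ (v : Z ⇒ E) → e ∘ v ≡ h → v ≡ u))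

  record Product (A B : Obj) : Set (o ⊔ ℓ) where
    field
      A×B       : Obj
      π₁        : A×B ⇒ A
      π₂        : A×B ⇒ B
      universal : ∀ {Z} (h₁ : Z ⇒ A) (h₂ : Z ⇒ B) →
                  Σ[ u ∈ Z ⇒ A×B ] ((π₁ ∘ u ≡ h₁ × π₂ ∘ u ≡ h₂) ×
                    (∀ (v : Z ⇒ A×B) → π₁ ∘ v ≡ h₁ → π₂ ∘ v ≡ h₂ → v ≡ u))

  HasBinaryProducts : Set (o ⊔ ℓ)
  HasBinaryProducts = ∀ (A B : Obj) → Product A B

  record SubobjectClassifier (𝟙 : Obj) (term : IsTerminal 𝟙) : Set (o ⊔ ℓ) where
    open IsTerminal term
    field
      Ω        : Obj
      true     : 𝟙 ⇒ Ω
      pullback : ∀ {A} (χ : A ⇒ Ω) → HasPullback true χ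
      classify : ∀ {X A} (i : X ⇒ A) → Mono i →
                 Σ[ χ ∈ A ⇒ Ω ] (IsPullback true χ (! X) i ×
                   (∀ (χ' : A ⇒ Ω) → IsPullback true χ' (! X) i → χ' ≡ χ))

  module _ {o' ℓ'} {D : Category o' ℓ'} (F : Functor D C) where
    private module D = Category D
    open Functor F

    record Cone : Set (o ⊔ ℓ ⊔ o' ⊔ ℓ') where
      field
        N       : Obj
        ψ       : ∀ (X : D.Obj) → N ⇒ F₀ X
        commute : ∀ {X Y} (f : X D.⇒ Y) → F₁ f ∘ ψ X ≡ ψ Y

    record Limit : Set (o ⊔ ℓ ⊔ o' ⊔ ℓ') where
      field
        cone      : Cone
      open Cone cone
      field
        universal : ∀ (K : Cone) →
                    Σ[ u ∈ Cone.N K ⇒ N ] ((∀ X → ψ X ∘ u ≡ Cone.ψ K X) ×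
                      (∀ (v : Cone.N K ⇒ N) → (∀ X → ψ X ∘ v ≡ Cone.ψ K X) → v ≡ u))

-- Monos pull back along arbitrary maps: pull true back along χₘ ∘ k and factor the
-- result through the classifying square of m. The diagonal B → B × B is monic, and
-- its pullback along ⟨ f , g ⟩ is an equalizer of f and g. Equalizers and binary
-- products give pullbacks, and with the terminal object they give all finite
-- products. The limit of a diagram with finitely many morphisms is then the joint
-- equalizer of finitely many parallel pairs out of a finite product, one component
-- per morphism.
module Submission where

open import Level using (_⊔_)
open import Data.Nat using (ℕ; zero; suc)
open import Data.Fin using (Fin; zero; suc)
open import Data.Sum using (inj₁; inj₂; [_,_])
open import Data.Product using (Σ-syntax; _×_; _,_; proj₁; proj₂)
open import Function.Bundles using (_↔_; Inverse)
open import Relation.Binary.PropositionalEquality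
  using (_≡_; refl; sym; trans; cong; subst; module ≡-Reasoning)

open import Defs

module _ {o ℓ} (C : Category o ℓ) where
  open Category C
  open ≡-Reasoning

  pullˡ : ∀ {W X Y Z} {a : Y ⇒ Z} {b : X ⇒ Y} {c : X ⇒ Z} (x : W ⇒ X) →
          a ∘ b ≡ c → a ∘ (b ∘ x) ≡ c ∘ x
  pullˡ x ab≡c = trans (sym (assoc _ _ _)) (cong (_∘ x) ab≡c)

  !-unique₂ : ∀ {T} → IsTerminal C T → ∀ {Z} (a b : Z ⇒ T) → a ≡ b
  !-unique₂ term a b = trans (!-unique a) (sym (!-unique b))
    where open IsTerminal term

  module BinaryProduct {A B : Obj} (P : Product C A B) where
    open Product P public using (A×B; π₁; π₂)
    open Product P using (universal)

    ⟨_,_⟩ : ∀ {Z} → Z ⇒ A → Z ⇒ B → Z ⇒ A×B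
    ⟨ h₁ , h₂ ⟩ = proj₁ (universal h₁ h₂)

    π₁∘⟨⟩ : ∀ {Z} {h₁ : Z ⇒ A} {h₂ : Z ⇒ B} → π₁ ∘ ⟨ h₁ , h₂ ⟩ ≡ h₁
    π₁∘⟨⟩ {h₁ = h₁} {h₂} = proj₁ (proj₁ (proj₂ (universal h₁ h₂)))

    π₂∘⟨⟩ : ∀ {Z} {h₁ : Z ⇒ A} {h₂ : Z ⇒ B} → π₂ ∘ ⟨ h₁ , h₂ ⟩ ≡ h₂
    π₂∘⟨⟩ {h₁ = h₁} {h₂} = proj₂ (proj₁ (proj₂ (universal h₁ h₂)))

    ⟨⟩-unique : ∀ {Z} {h₁ : Z ⇒ A} {h₂ : Z ⇒ B} (v : Z ⇒ A×B) →
                π₁ ∘ v ≡ h₁ → π₂ ∘ v ≡ h₂ → v ≡ ⟨ h₁ , h₂ ⟩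
    ⟨⟩-unique {h₁ = h₁} {h₂} = proj₂ (proj₂ (universal h₁ h₂))

    ⟨⟩-ext : ∀ {Z} (v w : Z ⇒ A×B) → π₁ ∘ v ≡ π₁ ∘ w → π₂ ∘ v ≡ π₂ ∘ w → v ≡ w
    ⟨⟩-ext v w p q = trans (⟨⟩-unique v p q) (sym (⟨⟩-unique w refl refl))

  module EqualizerOf {A B : Obj} {f g : A ⇒ B} (Eq : Equalizer C f g) where
    open Equalizer Eq public using (E; e; equality)
    open Equalizer Eq using (universal)

    factor : ∀ {Z} (h : Z ⇒ A) → f ∘ h ≡ g ∘ h → Z ⇒ E
    factor h fh≡gh = proj₁ (universal h fh≡gh)

    e∘factor : ∀ {Z} {h : Z ⇒ A} (fh≡gh : f ∘ h ≡ g ∘ h) → e ∘ factor h fh≡gh ≡ h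
    e∘factor {h = h} fh≡gh = proj₁ (proj₂ (universal h fh≡gh))

    factor-unique : ∀ {Z} {h : Z ⇒ A} (fh≡gh : f ∘ h ≡ g ∘ h) (v : Z ⇒ E) →
                    e ∘ v ≡ h → v ≡ factor h fh≡gh
    factor-unique {h = h} fh≡gh = proj₂ (proj₂ (universal h fh≡gh))

  module Diagonal {B : Obj} (B×B : Product C B B) where
    open BinaryProduct B×B

    Δ : B ⇒ A×B
    Δ = ⟨ id , id ⟩

    π₁∘Δ∘ : ∀ {Z} (x : Z ⇒ B) → π₁ ∘ (Δ ∘ x) ≡ x
    π₁∘Δ∘ x = trans (pullˡ x π₁∘⟨⟩) (identityˡ x)

    π₂∘Δ∘ : ∀ {Z} (x : Z ⇒ B) → π₂ ∘ (Δ ∘ x) ≡ x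
    π₂∘Δ∘ x = trans (pullˡ x π₂∘⟨⟩) (identityˡ x)

    Δ-mono : Mono C Δ
    Δ-mono a b Δa≡Δb = begin
      a              ≡⟨ sym (π₁∘Δ∘ a) ⟩
      π₁ ∘ (Δ ∘ a)   ≡⟨ cong (π₁ ∘_) Δa≡Δb ⟩
      π₁ ∘ (Δ ∘ b)   ≡⟨ π₁∘Δ∘ b ⟩
      b              ∎

    equalizer-from-pullback-of-Δ : ∀ {A} (f g : A ⇒ B) →
                                   HasPullback C Δ ⟨ f , g ⟩ → Equalizer C f g
    equalizer-from-pullback-of-Δ f g pb = record
      { E = P ; e = p₂ ; equality = equality ; universal = universal }
      where
      open HasPullback pb
      open IsPullback isPullback using (commute)

      π₁∘⟨f,g⟩∘ : ∀ {Z} (h : Z ⇒ _) → π₁ ∘ (⟨ f , g ⟩ ∘ h) ≡ f ∘ h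
      π₁∘⟨f,g⟩∘ h = pullˡ h π₁∘⟨⟩

      π₂∘⟨f,g⟩∘ : ∀ {Z} (h : Z ⇒ _) → π₂ ∘ (⟨ f , g ⟩ ∘ h) ≡ g ∘ h
      π₂∘⟨f,g⟩∘ h = pullˡ h π₂∘⟨⟩

      equality : f ∘ p₂ ≡ g ∘ p₂
      equality = begin
        f ∘ p₂                  ≡⟨ sym (π₁∘⟨f,g⟩∘ p₂) ⟩
        π₁ ∘ (⟨ f , g ⟩ ∘ p₂)   ≡⟨ cong (π₁ ∘_) (sym commute) ⟩
        π₁ ∘ (Δ ∘ p₁)           ≡⟨ π₁∘Δ∘ p₁ ⟩
        p₁                      ≡⟨ sym (π₂∘Δ∘ p₁) ⟩
        π₂ ∘ (Δ ∘ p₁)           ≡⟨ cong (π₂ ∘_) commute ⟩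
        π₂ ∘ (⟨ f , g ⟩ ∘ p₂)   ≡⟨ π₂∘⟨f,g⟩∘ p₂ ⟩
        g ∘ p₂                  ∎

      universal : ∀ {Z} (h : Z ⇒ _) → f ∘ h ≡ g ∘ h →
                  Σ[ u ∈ Z ⇒ P ] (p₂ ∘ u ≡ h × (∀ (v : Z ⇒ P) → p₂ ∘ v ≡ h → v ≡ u))
      universal h fh≡gh =
        let (u , (_ , p₂u≡h) , unique) = IsPullback.universal isPullback (f ∘ h) h Δfh≡⟨f,g⟩h
        in u , p₂u≡h , λ v p₂v≡h → unique v (p₁-determined v p₂v≡h) p₂v≡h
        where
        Δfh≡⟨f,g⟩h : Δ ∘ (f ∘ h) ≡ ⟨ f , g ⟩ ∘ h
        Δfh≡⟨f,g⟩h = ⟨⟩-ext _ _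
          (trans (π₁∘Δ∘ (f ∘ h)) (sym (π₁∘⟨f,g⟩∘ h)))
          (trans (π₂∘Δ∘ (f ∘ h)) (trans fh≡gh (sym (π₂∘⟨f,g⟩∘ h))))

        p₁-determined : ∀ v → p₂ ∘ v ≡ h → p₁ ∘ v ≡ f ∘ h
        p₁-determined v p₂v≡h = begin
          p₁ ∘ v                        ≡⟨ sym (π₁∘Δ∘ (p₁ ∘ v)) ⟩
          π₁ ∘ (Δ ∘ (p₁ ∘ v))           ≡⟨ cong (π₁ ∘_) (pullˡ v commute) ⟩
          π₁ ∘ ((⟨ f , g ⟩ ∘ p₂) ∘ v)   ≡⟨ cong (π₁ ∘_) (assoc _ _ _) ⟩
          π₁ ∘ (⟨ f , g ⟩ ∘ (p₂ ∘ v))   ≡⟨ π₁∘⟨f,g⟩∘ (p₂ ∘ v) ⟩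
          f ∘ (p₂ ∘ v)                  ≡⟨ cong (f ∘_) p₂v≡h ⟩
          f ∘ h                         ∎

  pullback-of-mono : ∀ {𝟙} {term : IsTerminal C 𝟙} → SubobjectClassifier C 𝟙 term →
                     ∀ {X A B} {m : X ⇒ B} → Mono C m → (k : A ⇒ B) → HasPullback C m k
  pullback-of-mono {term = term} SC {X} {m = m} m-mono k = record
    { P = Q.P ; p₁ = w ; p₂ = Q.p₂
    ; isPullback = record { commute = mw≡kq₂ ; universal = universal } }
    where
    open IsTerminal term
    open SubobjectClassifier SC
    χ = proj₁ (classify m m-mono)
    module Sq = IsPullback (proj₁ (proj₂ (classify m m-mono)))
    module Q = HasPullback (pullback (χ ∘ k))
    module Q′ = IsPullback Q.isPullback

    w-spec = Sq.universal Q.p₁ (k ∘ Q.p₂) (trans Q′.commute (assoc _ _ _))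
    w = proj₁ w-spec
    mw≡kq₂ : m ∘ w ≡ k ∘ Q.p₂
    mw≡kq₂ = proj₂ (proj₁ (proj₂ w-spec))

    universal : ∀ {Z} (h₁ : Z ⇒ X) (h₂ : Z ⇒ _) → m ∘ h₁ ≡ k ∘ h₂ →
                Σ[ u ∈ Z ⇒ Q.P ] ((w ∘ u ≡ h₁ × Q.p₂ ∘ u ≡ h₂) ×
                  (∀ (v : Z ⇒ Q.P) → w ∘ v ≡ h₁ → Q.p₂ ∘ v ≡ h₂ → v ≡ u))
    universal {Z} h₁ h₂ mh₁≡kh₂ =
      let (u , (_ , q₂u≡h₂) , unique) = Q′.universal (! Z) h₂ classified
          wu≡h₁ = m-mono _ _ (begin
            m ∘ (w ∘ u)       ≡⟨ pullˡ u mw≡kq₂ ⟩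
            (k ∘ Q.p₂) ∘ u    ≡⟨ assoc _ _ _ ⟩
            k ∘ (Q.p₂ ∘ u)    ≡⟨ cong (k ∘_) q₂u≡h₂ ⟩
            k ∘ h₂            ≡⟨ sym mh₁≡kh₂ ⟩
            m ∘ h₁            ∎)
      in u , (wu≡h₁ , q₂u≡h₂) , λ v _ q₂v≡h₂ → unique v (!-unique₂ term _ _) q₂v≡h₂
      where
      classified : true ∘ ! Z ≡ (χ ∘ k) ∘ h₂
      classified = begin
        true ∘ ! Z            ≡⟨ cong (true ∘_) (!-unique₂ term _ _) ⟩
        true ∘ (! X ∘ h₁)     ≡⟨ pullˡ h₁ Sq.commute ⟩
        (χ ∘ m) ∘ h₁          ≡⟨ assoc _ _ _ ⟩
        χ ∘ (m ∘ h₁)          ≡⟨ cong (χ ∘_) mh₁≡kh₂ ⟩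
        χ ∘ (k ∘ h₂)          ≡⟨ sym (assoc _ _ _) ⟩
        (χ ∘ k) ∘ h₂          ∎

  pullback-from-equalizer : ∀ {A B Cc} {f : A ⇒ Cc} {g : B ⇒ Cc} (P : Product C A B) →
    let open BinaryProduct P in Equalizer C (f ∘ π₁) (g ∘ π₂) → HasPullback C f g
  pullback-from-equalizer {f = f} {g} P Eq = record
    { P = E ; p₁ = π₁ ∘ e ; p₂ = π₂ ∘ e
    ; isPullback = record
      { commute = trans (sym (assoc _ _ _)) (trans equality (assoc _ _ _))
      ; universal = universal } }
    where
    open BinaryProduct P
    open EqualizerOf Eq

    universal : ∀ {Z} (h₁ : Z ⇒ _) (h₂ : Z ⇒ _) → f ∘ h₁ ≡ g ∘ h₂ →
                Σ[ u ∈ Z ⇒ E ] (((π₁ ∘ e) ∘ u ≡ h₁ × (π₂ ∘ e) ∘ u ≡ h₂) ×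
                  (∀ (v : Z ⇒ E) → (π₁ ∘ e) ∘ v ≡ h₁ → (π₂ ∘ e) ∘ v ≡ h₂ → v ≡ u))
    universal h₁ h₂ fh₁≡gh₂ =
        u
      , (trans (assoc _ _ _) (trans (cong (π₁ ∘_) e∘u) π₁∘⟨⟩)
      ,  trans (assoc _ _ _) (trans (cong (π₂ ∘_) e∘u) π₂∘⟨⟩))
      , λ v p q → factor-unique agree v
          (⟨⟩-unique _ (trans (sym (assoc _ _ _)) p) (trans (sym (assoc _ _ _)) q))
      where
      agree : (f ∘ π₁) ∘ ⟨ h₁ , h₂ ⟩ ≡ (g ∘ π₂) ∘ ⟨ h₁ , h₂ ⟩
      agree = begin
        (f ∘ π₁) ∘ ⟨ h₁ , h₂ ⟩   ≡⟨ assoc _ _ _ ⟩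
        f ∘ (π₁ ∘ ⟨ h₁ , h₂ ⟩)   ≡⟨ cong (f ∘_) π₁∘⟨⟩ ⟩
        f ∘ h₁                   ≡⟨ fh₁≡gh₂ ⟩
        g ∘ h₂                   ≡⟨ cong (g ∘_) (sym π₂∘⟨⟩) ⟩
        g ∘ (π₂ ∘ ⟨ h₁ , h₂ ⟩)   ≡⟨ sym (assoc _ _ _) ⟩
        (g ∘ π₂) ∘ ⟨ h₁ , h₂ ⟩   ∎
      u = factor ⟨ h₁ , h₂ ⟩ agree
      e∘u = e∘factor agree

  record IndexedProduct {ι} {I : Set ι} (A : I → Obj) : Set (o ⊔ ℓ ⊔ ι) where
    field
      ∏         : Obj
      π         : ∀ i → ∏ ⇒ A i
      ⟨_⟩       : ∀ {Z} → (∀ i → Z ⇒ A i) → Z ⇒ ∏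
      π∘⟨⟩      : ∀ {Z} (h : ∀ i → Z ⇒ A i) i → π i ∘ ⟨ h ⟩ ≡ h i
      ⟨⟩-unique : ∀ {Z} {h : ∀ i → Z ⇒ A i} (v : Z ⇒ ∏) → (∀ i → π i ∘ v ≡ h i) → v ≡ ⟨ h ⟩

    ⟨⟩-ext : ∀ {Z} (v w : Z ⇒ ∏) → (∀ i → π i ∘ v ≡ π i ∘ w) → v ≡ w
    ⟨⟩-ext v w p = trans (⟨⟩-unique v p) (sym (⟨⟩-unique w (λ _ → refl)))

  finite-product : ∀ {𝟙} → IsTerminal C 𝟙 → HasBinaryProducts C →
                   ∀ n (A : Fin n → Obj) → IndexedProduct A
  finite-product {𝟙} term _ zero A = record
    { ∏ = 𝟙 ; π = λ () ; ⟨_⟩ = λ {Z} _ → ! Z ; π∘⟨⟩ = λ _ () ; ⟨⟩-unique = λ v _ → !-unique v }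
    where open IsTerminal term
  finite-product term prod (suc n) A = record
    { ∏ = A×B ; π = π ; ⟨_⟩ = tuple ; π∘⟨⟩ = π∘tuple ; ⟨⟩-unique = tuple-unique }
    where
    module Tail = IndexedProduct (finite-product term prod n (λ i → A (suc i)))
    open BinaryProduct (prod (A zero) Tail.∏)

    π : ∀ i → A×B ⇒ A i
    π zero    = π₁
    π (suc i) = Tail.π i ∘ π₂

    tuple : ∀ {Z} → (∀ i → Z ⇒ A i) → Z ⇒ A×B
    tuple h = ⟨ h zero , Tail.⟨ (λ i → h (suc i)) ⟩ ⟩

    π∘tuple : ∀ {Z} (h : ∀ i → Z ⇒ A i) i → π i ∘ tuple h ≡ h i
    π∘tuple h zero    = π₁∘⟨⟩
    π∘tuple h (suc i) =
      trans (assoc _ _ _) (trans (cong (Tail.π i ∘_) π₂∘⟨⟩) (Tail.π∘⟨⟩ _ i))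

    tuple-unique : ∀ {Z} {h : ∀ i → Z ⇒ A i} (v : Z ⇒ A×B) →
                   (∀ i → π i ∘ v ≡ h i) → v ≡ tuple h
    tuple-unique v H = ⟨⟩-unique v (H zero)
      (Tail.⟨⟩-unique (π₂ ∘ v) (λ i → trans (sym (assoc _ _ _)) (H (suc i))))

  indexed-product-⊎ : ∀ {ι κ} {I : Set ι} {J : Set κ} {A : I → Obj} {B : J → Obj} →
    (PA : IndexedProduct A) (PB : IndexedProduct B) →
    Product C (IndexedProduct.∏ PA) (IndexedProduct.∏ PB) → IndexedProduct [ A , B ]
  indexed-product-⊎ {A = A} {B} PA PB P = record
    { ∏ = A×B ; π = π ; ⟨_⟩ = tuple ; π∘⟨⟩ = π∘tuple ; ⟨⟩-unique = tuple-unique }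
    where
    module PA = IndexedProduct PA
    module PB = IndexedProduct PB
    open BinaryProduct P

    π : ∀ c → A×B ⇒ [ A , B ] c
    π (inj₁ i) = PA.π i ∘ π₁
    π (inj₂ j) = PB.π j ∘ π₂

    tuple : ∀ {Z} → (∀ c → Z ⇒ [ A , B ] c) → Z ⇒ A×B
    tuple h = ⟨ PA.⟨ (λ i → h (inj₁ i)) ⟩ , PB.⟨ (λ j → h (inj₂ j)) ⟩ ⟩

    π∘tuple : ∀ {Z} (h : ∀ c → Z ⇒ [ A , B ] c) c → π c ∘ tuple h ≡ h c
    π∘tuple h (inj₁ i) = trans (assoc _ _ _) (trans (cong (PA.π i ∘_) π₁∘⟨⟩) (PA.π∘⟨⟩ _ i))
    π∘tuple h (inj₂ j) = trans (assoc _ _ _) (trans (cong (PB.π j ∘_) π₂∘⟨⟩) (PB.π∘⟨⟩ _ j))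

    tuple-unique : ∀ {Z} {h : ∀ c → Z ⇒ [ A , B ] c} (v : Z ⇒ A×B) →
                   (∀ c → π c ∘ v ≡ h c) → v ≡ tuple h
    tuple-unique v H = ⟨⟩-unique v
      (PA.⟨⟩-unique (π₁ ∘ v) (λ i → trans (sym (assoc _ _ _)) (H (inj₁ i))))
      (PB.⟨⟩-unique (π₂ ∘ v) (λ j → trans (sym (assoc _ _ _)) (H (inj₂ j))))

  record JointEqualizer {ι} {I : Set ι} {A : Obj} {B : I → Obj}
                        (f g : ∀ i → A ⇒ B i) : Set (o ⊔ ℓ ⊔ ι) where
    field
      E             : Obj
      e             : E ⇒ A
      equality      : ∀ i → f i ∘ e ≡ g i ∘ e
      factor        : ∀ {Z} (h : Z ⇒ A) → (∀ i → f i ∘ h ≡ g i ∘ h) → Z ⇒ E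
      e∘factor      : ∀ {Z} {h : Z ⇒ A} (fh≡gh : ∀ i → f i ∘ h ≡ g i ∘ h) →
                      e ∘ factor h fh≡gh ≡ h
      factor-unique : ∀ {Z} {h : Z ⇒ A} (fh≡gh : ∀ i → f i ∘ h ≡ g i ∘ h) (v : Z ⇒ E) →
                      e ∘ v ≡ h → v ≡ factor h fh≡gh

  joint-equalizer : ∀ {ι} {I : Set ι} {A : Obj} {B : I → Obj} → IndexedProduct B →
                    (∀ {X Y} (f g : X ⇒ Y) → Equalizer C f g) →
                    (f g : ∀ i → A ⇒ B i) → JointEqualizer f g
  joint-equalizer PB equalizer f g = record
    { E = E ; e = e ; factor = λ h fh≡gh → factor h (tupled fh≡gh)
    ; equality = untupled equality
    ; e∘factor = λ fh≡gh → e∘factor (tupled fh≡gh)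
    ; factor-unique = λ fh≡gh → factor-unique (tupled fh≡gh) }
    where
    open IndexedProduct PB
    open EqualizerOf (equalizer ⟨ f ⟩ ⟨ g ⟩)

    tupled : ∀ {Z} {h : Z ⇒ _} → (∀ i → f i ∘ h ≡ g i ∘ h) → ⟨ f ⟩ ∘ h ≡ ⟨ g ⟩ ∘ h
    tupled {h = h} fh≡gh = ⟨⟩-ext _ _ λ i → begin
      π i ∘ (⟨ f ⟩ ∘ h)   ≡⟨ pullˡ h (π∘⟨⟩ f i) ⟩
      f i ∘ h             ≡⟨ fh≡gh i ⟩
      g i ∘ h             ≡⟨ sym (pullˡ h (π∘⟨⟩ g i)) ⟩
      π i ∘ (⟨ g ⟩ ∘ h)   ∎

    untupled : ∀ {Z} {h : Z ⇒ _} → ⟨ f ⟩ ∘ h ≡ ⟨ g ⟩ ∘ h → ∀ i → f i ∘ h ≡ g i ∘ h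
    untupled {h = h} fh≡gh i = begin
      f i ∘ h             ≡⟨ sym (pullˡ h (π∘⟨⟩ f i)) ⟩
      π i ∘ (⟨ f ⟩ ∘ h)   ≡⟨ cong (π i ∘_) fh≡gh ⟩
      π i ∘ (⟨ g ⟩ ∘ h)   ≡⟨ pullˡ h (π∘⟨⟩ g i) ⟩
      g i ∘ h             ∎

  module FiniteLimit
    (prod : HasBinaryProducts C)
    (product : ∀ n (A : Fin n → Obj) → IndexedProduct A)
    (equalizer : ∀ {X Y} (f g : X ⇒ Y) → Equalizer C f g)
    {o' ℓ'} {D : Category o' ℓ'} (n : ℕ) (enum : Mor D ↔ Fin n) (F : Functor D C) where
    private module D = Category D
    open Functor F
    open Inverse enum using (to; from; strictlyInverseʳ)

    dom cod : Mor D → D.Obj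
    dom m = proj₁ m
    cod m = proj₁ (proj₂ m)

    arr : (m : Mor D) → dom m D.⇒ cod m
    arr m = proj₂ (proj₂ m)

    identity-at : D.Obj → Mor D
    identity-at X = X , X , D.id

    every-morphism-enumerated : (P : Mor D → Set ℓ) → (∀ k → P (from k)) → ∀ m → P m
    every-morphism-enumerated P P-from m = subst P (strictlyInverseʳ m) (P-from (to m))

    cast : ∀ {X Y} → X ≡ Y → F₀ X ⇒ F₀ Y
    cast refl = id

    cast∘ : ∀ {Z} (h : ∀ X → Z ⇒ F₀ X) {X Y} (p : X ≡ Y) → cast p ∘ h X ≡ h Y
    cast∘ h refl = identityˡ _

    -- The product has one factor F(cod m) per morphism m; the factor of id_X serves as
    -- the projection onto F X, up to a cast since from (to id_X) ≡ id_X only propositionally.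
    T : Fin n → Obj
    T k = F₀ (cod (from k))

    module Π = IndexedProduct (product n T)

    cod-from-to-identity : ∀ X → cod (from (to (identity-at X))) ≡ X
    cod-from-to-identity X = cong cod (strictlyInverseʳ (identity-at X))

    component : ∀ X → Π.∏ ⇒ F₀ X
    component X = cast (cod-from-to-identity X) ∘ Π.π (to (identity-at X))

    component∘⟨⟩ : ∀ {Z} (h : ∀ X → Z ⇒ F₀ X) X →
                   component X ∘ Π.⟨ (λ k → h (cod (from k))) ⟩ ≡ h X
    component∘⟨⟩ h X =
      trans (assoc _ _ _) (trans (cong (cast (cod-from-to-identity X) ∘_) (Π.π∘⟨⟩ _ _)) (cast∘ h (cod-from-to-identity X)))

    -- inj₁ k forces the factor of m = from k to agree with that of id (cod m), so the
    -- product carries no redundant data; inj₂ k makes the components compatible along m.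
    lhs rhs : ∀ c → Π.∏ ⇒ [ T , T ] c
    lhs (inj₁ k) = Π.π k
    lhs (inj₂ k) = component (cod (from k))
    rhs (inj₁ k) = component (cod (from k))
    rhs (inj₂ k) = F₁ (arr (from k)) ∘ component (dom (from k))

    module J = JointEqualizer
      (joint-equalizer (indexed-product-⊎ (product n T) (product n T) (prod _ _)) equalizer lhs rhs)

    cone : Cone C F
    cone = record { N = J.E ; ψ = λ X → component X ∘ J.e ; commute = commute }
      where
      commute : ∀ {X Y} (g : X D.⇒ Y) → F₁ g ∘ (component X ∘ J.e) ≡ component Y ∘ J.e
      commute g = every-morphism-enumerated
        (λ m → F₁ (arr m) ∘ (component (dom m) ∘ J.e) ≡ component (cod m) ∘ J.e)
        (λ k → sym (trans (J.equality (inj₂ k)) (assoc _ _ _)))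
        (_ , _ , g)

    universal : ∀ (K : Cone C F) →
                Σ[ u ∈ Cone.N K ⇒ J.E ] ((∀ X → (component X ∘ J.e) ∘ u ≡ Cone.ψ K X) ×
                  (∀ (v : Cone.N K ⇒ J.E) → (∀ X → (component X ∘ J.e) ∘ v ≡ Cone.ψ K X) → v ≡ u))
    universal K = J.factor point point-equalized , legs , unique
      where
      module K = Cone K

      point : K.N ⇒ Π.∏
      point = Π.⟨ (λ k → K.ψ (cod (from k))) ⟩

      point-equalized : ∀ c → lhs c ∘ point ≡ rhs c ∘ point
      point-equalized (inj₁ k) = trans (Π.π∘⟨⟩ _ k) (sym (component∘⟨⟩ K.ψ _))
      point-equalized (inj₂ k) = begin
        component (cod m) ∘ point                  ≡⟨ component∘⟨⟩ K.ψ _ ⟩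
        K.ψ (cod m)                                ≡⟨ sym (K.commute (arr m)) ⟩
        F₁ (arr m) ∘ K.ψ (dom m)                   ≡⟨ cong (F₁ (arr m) ∘_) (sym (component∘⟨⟩ K.ψ _)) ⟩
        F₁ (arr m) ∘ (component (dom m) ∘ point)   ≡⟨ sym (assoc _ _ _) ⟩
        (F₁ (arr m) ∘ component (dom m)) ∘ point   ∎
        where m = from k

      legs : ∀ X → (component X ∘ J.e) ∘ J.factor point point-equalized ≡ K.ψ X
      legs X = trans (assoc _ _ _)
        (trans (cong (component X ∘_) (J.e∘factor point-equalized)) (component∘⟨⟩ K.ψ X))

      unique : ∀ v → (∀ X → (component X ∘ J.e) ∘ v ≡ K.ψ X) → v ≡ J.factor point point-equalized
      unique v legs-v = J.factor-unique point-equalized v (Π.⟨⟩-unique (J.e ∘ v) λ k → begin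
        Π.π k ∘ (J.e ∘ v)                    ≡⟨ pullˡ v (J.equality (inj₁ k)) ⟩
        (component (cod (from k)) ∘ J.e) ∘ v ≡⟨ legs-v _ ⟩
        K.ψ (cod (from k))                   ∎)

    limit : Limit C F
    limit = record { cone = cone ; universal = universal }

  finite-limit : HasBinaryProducts C → (∀ n (A : Fin n → Obj) → IndexedProduct A) →
                 (∀ {X Y} (f g : X ⇒ Y) → Equalizer C f g) →
                 ∀ {o' ℓ'} (D : Category o' ℓ') → FiniteCategory D → (F : Functor D C) → Limit C F
  finite-limit prod product equalizer D (n , enum) F =
    FiniteLimit.limit prod product equalizer n enum F

mainTheorem12 : ∀ {o ℓ o' ℓ'} (C : Category o ℓ) (𝟙 : Category.Obj C) (term : IsTerminal C 𝟙) →
    SubobjectClassifier C 𝟙 term → HasBinaryProducts C →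
    (∀ (D : Category o' ℓ') → FiniteCategory D → (F : Functor D C) → Limit C F)
    × (∀ {A B : Category.Obj C} (f g : Category._⇒_ C A B) → Equalizer C f g)
    × (∀ {A B Cc : Category.Obj C} (f : Category._⇒_ C A Cc) (g : Category._⇒_ C B Cc) → HasPullback C f g)
mainTheorem12 C 𝟙 term SC prod = limit , equalizer , pullback
  where
  open Category C

  equalizer : ∀ {A B} (f g : A ⇒ B) → Equalizer C f g
  equalizer f g = equalizer-from-pullback-of-Δ f g (pullback-of-mono C SC Δ-mono _)
    where open Diagonal C (prod _ _)

  pullback : ∀ {A B Cc} (f : A ⇒ Cc) (g : B ⇒ Cc) → HasPullback C f g
  pullback f g = pullback-from-equalizer C (prod _ _) (equalizer _ _)

  limit : ∀ D → FiniteCategory D → (F : Functor D C) → Limit C F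
  limit = finite-limit C prod (finite-product C term prod) equalizer
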